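{- Let $p\ge 5$ be a prime and $\delta$ a positive integer with $p\nmid \delta$. Then $\ell_p(\delta)\le L_p$.
   Context: For a prime $p\ge 5$ and a positive integer $\delta$ with $p\nmid\delta$, $\ell_p(\delta)$ is the smallest positive integer $x$ such that the Legendre symbol $\big(\frac{ -3\delta^2x^2-12}{p}\big)\in\{0,1\}$. Also $L_p=\frac{p+3}{4}$ if $p\equiv 1\pmod{12}$; $L_p=\frac{p-1}{4}$ if $p\equiv 5\pmod{12}$; $L_p=\frac{p+5}{4}$ if $p\equiv 7\pmod{12}$; $L_p=\frac{p+1}{4}$ if $p\equiv 11\pmod{12}$. -}

module Defs where

open import Data.Nat using (ℕ; suc; _+_; _*_; _∸_; _≤_; _<_; NonZero)
open import Data.Nat.DivMod using (_/_; _%_)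
open import Data.Integer as ℤ using (ℤ; +_)
open import Data.Integer.Divisibility as ℤD using ()
open import Data.Product using (∃; _×_)
open import Relation.Nullary using (¬_)

-- Legendre symbol (a / p) ∈ {0, 1}  ⇔  a is a square modulo p
-- (value 0: p ∣ a, witnessed by y = 0; value 1: a nonzero quadratic residue).
LegendreIn01 : ℕ → ℤ → Set
LegendreIn01 p a = ∃ λ (y : ℤ) → (+ p) ℤD.∣ (y ℤ.* y ℤ.- a)

Cond : ℕ → ℕ → ℕ → Set
Cond p δ x = LegendreIn01 p (ℤ.- (+ 3) ℤ.* (+ δ) ℤ.* (+ δ) ℤ.* (+ x) ℤ.* (+ x) ℤ.- (+ 12))

IsEllp : ℕ → ℕ → ℕ → Set
IsEllp p δ x = (1 ≤ x) × Cond p δ x × (∀ y → 1 ≤ y → y < x → ¬ Cond p δ y)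

-- L_p, by cases on p mod 12 (only meaningful for primes p ≥ 5)
Lp : ℕ → ℕ
Lp p with p % 12
... | 1  = (p + 3) / 4
... | 5  = (p ∸ 1) / 4
... | 7  = (p + 5) / 4
... | 11 = (p + 1) / 4
... | _  = 0

-- Suppose no x ∈ [1, Lp] satisfies the condition, put L = Lp and p = 2q + 1, and consider
-- the conic y² + 3u² = −12 over 𝔽_p.  The condition on x says precisely that the conic has
-- a point with u = δx.  So for every point with u ≠ 0, the representative x ∈ [1, q] of
-- ±u/δ exceeds L, and the point is determined by x, the half of [0, p) containing u/δ and
-- the half containing y: there are at most 4(q − L) such points, and at most 2 with u = 0.
-- If −3 is not a square, all of the p + 1 points of the conic have u ≠ 0 (they are cut out
-- by the lines through one point, found by pigeonhole).  If −3 = s², the p − 1 points with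
-- y − su = a, y + su = −12/a are on the conic, and (s − 1)/2 is a primitive cube root of
-- unity, whose multiplication splits 𝔽_p^× into orbits of size 3, so 3 ∣ p − 1.  In both
-- cases the count contradicts the value of Lp on the residue classes of p modulo 12.

module Submission where

open import Data.Bool using (Bool; true; false; not; _∧_; if_then_else_)
open import Data.Bool.Properties using (not-¬; ∧-identityʳ; ∧-zeroʳ; if-float)
open import Data.Empty using (⊥; ⊥-elim)
open import Data.Fin as Fin using (Fin; toℕ; fromℕ<)
import Data.Fin.Properties as Fin
open import Data.Integer as ℤ using (ℤ; +_; 0ℤ; 1ℤ; ∣_∣)
open import Data.Integer.DivMod using (_%ℕ_; _/ℕ_; a≡a%ℕn+[a/ℕn]*n; n%ℕd<d)
import Data.Integer.Divisibility.Signed as ℤ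
import Data.Integer.Properties as ℤ
open import Data.Integer.Tactic.RingSolver using (solve)
open import Data.List using ([]; _∷_)
open import Data.Nat as ℕ
  using (ℕ; zero; suc; NonZero; NonTrivial; _≤_; _<_; _∸_; z≤n; s≤s; _≤?_; _<?_)
open import Data.Nat.Coprimality using (prime⇒coprime; coprime-Bézout)
open import Data.Nat.Divisibility as ℕ using (_∣_; _∣?_; divides)
open import Data.Nat.DivMod using (_%_; _/_)
import Data.Nat.DivMod as ℕ
open import Data.Nat.GCD using (module Bézout)
open import Data.Nat.Primality using (Prime; composite; prime⇒nonZero; euclidsLemma)
import Data.Nat.Properties as ℕ
import Data.Nat.Tactic.RingSolver as ℕ-Solver
open import Data.Product using (∃; _×_; _,_; proj₁; proj₂)
open import Data.Product.Function.NonDependent.Propositional using (_×-↔_)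
open import Data.Product.Properties using (,-injective)
open import Data.Sum as Sum using (_⊎_; inj₁; inj₂; [_,_]′)
open import Data.Sum.Function.Propositional using (_⊎-↔_)
open import Data.Sum.Properties using (inj₁-injective; inj₂-injective)
open import Data.Unit using (⊤)
open import Function.Base using (_∘_)
open import Function.Bundles using (_⇔_; mk⇔; _↔_; Inverse; module Equivalence)
open import Function.Properties.Inverse using (↔-refl; ↔-sym; ↔-trans)
open import Relation.Binary.Bundles using (Setoid)
open import Relation.Binary.PropositionalEquality
  using (_≡_; _≢_; refl; sym; trans; cong; subst; module ≡-Reasoning)
import Relation.Binary.Reasoning.Setoid
open import Relation.Nullary using (¬_; Dec; yes; no)
open import Relation.Nullary.Decidable as Dec using (⌊_⌋; from-no)

open import Defs

module Counting where

  open import Data.Nat using (_+_)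

  count : (ℕ → Bool) → ℕ → ℕ
  count f zero    = 0
  count f (suc n) = if f n then suc (count f n) else count f n

  infixl 6 _∖_
  _∖_ : (ℕ → Bool) → ℕ → ℕ → Bool
  (f ∖ a) x = f x ∧ not ⌊ x ℕ.≟ a ⌋

  ∖-self : ∀ f a → (f ∖ a) a ≡ false
  ∖-self f a with a ℕ.≟ a
  ... | yes _   = ∧-zeroʳ (f a)
  ... | no a≢a = ⊥-elim (a≢a refl)

  ∖-other : ∀ {f a x} → x ≢ a → (f ∖ a) x ≡ f x
  ∖-other {f} {a} {x} x≢a with x ℕ.≟ a
  ... | yes x≡a = ⊥-elim (x≢a x≡a)
  ... | no _    = ∧-identityʳ (f x)

  ∖-intro : ∀ f {a x} → f x ≡ true → x ≢ a → (f ∖ a) x ≡ true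
  ∖-intro f fx x≢a = trans (∖-other {f} x≢a) fx

  ∖-elim : ∀ f {a x} → (f ∖ a) x ≡ true → f x ≡ true × x ≢ a
  ∖-elim f {a} {x} f∖ax with f x | x ℕ.≟ a
  ... | true | no x≢a = refl , x≢a

  count-cong : ∀ {f g} n → (∀ {x} → x < n → f x ≡ g x) → count f n ≡ count g n
  count-cong zero    _   = refl
  count-cong (suc n) f≗g rewrite f≗g (ℕ.n<1+n n) | count-cong n (λ x<n → f≗g (ℕ.m<n⇒m<1+n x<n)) = refl

  count-∖ : ∀ {f a} n → a < n → f a ≡ true → count f n ≡ suc (count (f ∖ a) n)
  count-∖ {f} {a} (suc n) a<1+n fa with ℕ.m≤n⇒m<n∨m≡n (ℕ.s≤s⁻¹ a<1+n)
  ... | inj₂ refl = begin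
    count f (suc n)              ≡⟨ cong (λ b → if b then suc (count f n) else count f n) fa ⟩
    suc (count f n)              ≡⟨ cong suc (count-cong n (λ x<n → sym (∖-other {f} (ℕ.<⇒≢ x<n)))) ⟩
    suc c                        ≡⟨ cong (λ b → suc (if b then suc c else c)) (∖-self f n) ⟨
    suc (count (f ∖ n) (suc n))  ∎
    where
    open ≡-Reasoning
    c = count (f ∖ n) n
  ... | inj₁ a<n = begin
    (if f n then suc (count f n) else count f n)  ≡⟨ cong (λ c → if f n then suc c else c) (count-∖ n a<n fa) ⟩
    (if f n then suc (suc c) else suc c)          ≡⟨ if-float suc (f n) ⟨
    suc (if f n then suc c else c)
      ≡⟨ cong (λ b → suc (if b then suc c else c)) (∖-other {f} (ℕ.>⇒≢ a<n)) ⟨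
    suc (count (f ∖ a) (suc n))                   ∎
    where
    open ≡-Reasoning
    c = count (f ∖ a) n

  count≢0⇒∃ : ∀ {f} n → count f n ≢ 0 → ∃ λ a → a < n × f a ≡ true
  count≢0⇒∃     zero    c≢0 = ⊥-elim (c≢0 refl)
  count≢0⇒∃ {f} (suc n) c≢0 with f n in fn
  ... | true  = n , ℕ.n<1+n n , fn
  ... | false with a , a<n , fa ← count≢0⇒∃ n c≢0 = a , ℕ.m<n⇒m<1+n a<n , fa

  record FreeOrder3Action (σ : ℕ → ℕ) (n : ℕ) (f : ℕ → Bool) : Set where
    field
      bounded        : ∀ {x} → f x ≡ true → x < n
      closed         : ∀ {x} → f x ≡ true → f (σ x) ≡ true
      cubic          : ∀ {x} → f x ≡ true → σ (σ (σ x)) ≡ x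
      no-fixed-point : ∀ {x} → f x ≡ true → σ x ≢ x

  module _ {σ : ℕ → ℕ} {n : ℕ} where

    remove-orbit : ∀ {f a} → FreeOrder3Action σ n f → f a ≡ true →
                   FreeOrder3Action σ n (f ∖ a ∖ σ a ∖ σ (σ a)) ×
                   count f n ≡ 3 + count (f ∖ a ∖ σ a ∖ σ (σ a)) n
    remove-orbit {f} {a} act fa = action , size
      where
      open FreeOrder3Action act
      fa₁ = closed fa
      fa₂ = closed fa₁
      a₁≢a : σ a ≢ a
      a₁≢a = no-fixed-point fa
      a₂≢a₁ : σ (σ a) ≢ σ a
      a₂≢a₁ = no-fixed-point fa₁
      a₂≢a : σ (σ a) ≢ a
      a₂≢a a₂≡a = a₁≢a (trans (cong σ (sym a₂≡a)) (cubic fa))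

      size : count f n ≡ 3 + count (f ∖ a ∖ σ a ∖ σ (σ a)) n
      size = trans (count-∖ n (bounded fa) fa) (cong suc
             (trans (count-∖ n (bounded fa₁) (∖-intro f fa₁ a₁≢a)) (cong suc
                    (count-∖ n (bounded fa₂) (∖-intro (f ∖ a) (∖-intro f fa₂ a₂≢a) a₂≢a₁)))))

      preimage : ∀ {x b} → f x ≡ true → σ x ≡ b → x ≡ σ (σ b)
      preimage fx σx≡b = trans (sym (cubic fx)) (cong (λ z → σ (σ z)) σx≡b)

      action : FreeOrder3Action σ n (f ∖ a ∖ σ a ∖ σ (σ a))
      action = record
        { bounded        = λ gx → bounded (in-f gx)
        ; closed         = closed′
        ; cubic          = λ gx → cubic (in-f gx)
        ; no-fixed-point = λ gx → no-fixed-point (in-f gx)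
        }
        where
        in-f : ∀ {x} → (f ∖ a ∖ σ a ∖ σ (σ a)) x ≡ true → f x ≡ true
        in-f gx = proj₁ (∖-elim f (proj₁ (∖-elim (f ∖ a) (proj₁ (∖-elim (f ∖ a ∖ σ a) gx)))))
        closed′ : ∀ {x} → (f ∖ a ∖ σ a ∖ σ (σ a)) x ≡ true →
                  (f ∖ a ∖ σ a ∖ σ (σ a)) (σ x) ≡ true
        closed′ {x} gx
          with f∖a∖a₁x , x≢a₂ ← ∖-elim (f ∖ a ∖ σ a) gx
          with f∖ax , x≢a₁ ← ∖-elim (f ∖ a) f∖a∖a₁x
          with fx , x≢a ← ∖-elim f f∖ax =
          ∖-intro (f ∖ a ∖ σ a) (∖-intro (f ∖ a) (∖-intro f (closed fx)
            (λ σx≡a → x≢a₂ (preimage fx σx≡a)))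
            (λ σx≡a₁ → x≢a (trans (preimage fx σx≡a₁) (cubic fa))))
            (λ σx≡a₂ → x≢a₁ (trans (preimage fx σx≡a₂) (cubic fa₁)))

    3∣count : ∀ {f} → FreeOrder3Action σ n f → 3 ∣ count f n
    3∣count {f} = go (count f n) ℕ.≤-refl
      where
      go : ∀ fuel {f} → count f n ≤ fuel → FreeOrder3Action σ n f → 3 ∣ count f n
      go fuel {f} c≤fuel act with count f n ℕ.≟ 0
      ... | yes c≡0 = subst (3 ∣_) (sym c≡0) (3 ℕ.∣0)
      ... | no c≢0 with count≢0⇒∃ n c≢0
      ...   | a , _ , fa with remove-orbit act fa | fuel
      ...     | act′ , c≡3+c′ | suc fuel′ =
        subst (3 ∣_) (sym c≡3+c′) (ℕ.∣m∣n⇒∣m+n ℕ.∣-refl (go fuel′ c′≤fuel′ act′))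
        where
        c′≤fuel′ = ℕ.≤-trans (ℕ.m≤n+m _ 2) (ℕ.s≤s⁻¹ (subst (_≤ suc fuel′) c≡3+c′ c≤fuel))
      ...     | _ , c≡3+c′ | zero = ⊥-elim (c≢0 (ℕ.n≤0⇒n≡0 c≤fuel))

  count-positive : ∀ n → count (λ x → ⌊ 1 ≤? x ⌋) n ≡ n ∸ 1
  count-positive zero          = refl
  count-positive (suc zero)    = refl
  count-positive (suc (suc n)) = cong suc (count-positive (suc n))

module FiniteCardinality where

  open import Data.Nat using (_+_; _*_)

  injective⇒card≤ : ∀ {A B : Set} {m n} → A ↔ Fin m → B ↔ Fin n →
                    (f : A → B) → (∀ {a a′} → f a ≡ f a′ → a ≡ a′) → m ≤ n
  injective⇒card≤ A↔Fin B↔Fin f f-injective = Fin.injective⇒≤ {f = to B↔Fin ∘ f ∘ from A↔Fin}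
    λ eq → from-injective A↔Fin (f-injective (to-injective B↔Fin eq))
    where
    open Inverse using (to; from)
    to-injective : ∀ {X Y : Set} (X↔Y : X ↔ Y) {x x′} → to X↔Y x ≡ to X↔Y x′ → x ≡ x′
    to-injective X↔Y {x} {x′} eq = trans (sym (Inverse.strictlyInverseʳ X↔Y x))
                                     (trans (cong (from X↔Y) eq) (Inverse.strictlyInverseʳ X↔Y x′))
    from-injective : ∀ {X Y : Set} (X↔Y : X ↔ Y) {y y′} → from X↔Y y ≡ from X↔Y y′ → y ≡ y′
    from-injective X↔Y = to-injective (↔-sym X↔Y)

  Fin×Bool×Bool↔ : ∀ k → (Fin k × Bool × Bool) ↔ Fin (k * 4)
  Fin×Bool×Bool↔ k = ↔-sym (↔-trans (Fin.*↔× {k} {4})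
    (↔-refl ×-↔ ↔-trans (Fin.*↔× {2} {2}) (Fin.2↔Bool ×-↔ Fin.2↔Bool)))

  Fin×Bool×Bool⊎Bool↔ : ∀ k → ((Fin k × Bool × Bool) ⊎ Bool) ↔ Fin (k * 4 + 2)
  Fin×Bool×Bool⊎Bool↔ k = ↔-sym (↔-trans (Fin.+↔⊎ {k * 4} {2})
    (↔-sym (Fin×Bool×Bool↔ k) ⊎-↔ Fin.2↔Bool))

Least : (ℕ → Set) → ℕ → Set
Least Q x = 1 ≤ x × Q x × (∀ y → 1 ≤ y → y < x → ¬ Q y)

least-upTo? : ∀ {Q : ℕ → Set} → (∀ x → Dec (Q x)) → ∀ n →
              (∃ λ x → Least Q x × x ≤ n) ⊎ (∀ x → 1 ≤ x → x ≤ n → ¬ Q x)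
least-upTo? Q? zero = inj₂ λ x 1≤x x≤0 _ → ℕ.<-irrefl refl (ℕ.≤-trans 1≤x x≤0)
least-upTo? Q? (suc n) with least-upTo? Q? n
... | inj₁ (x , least , x≤n) = inj₁ (x , least , ℕ.m≤n⇒m≤1+n x≤n)
... | inj₂ none with Q? (suc n)
...   | yes Q[1+n] =
  inj₁ (suc n , (s≤s z≤n , Q[1+n] , λ y 1≤y y<1+n → none y 1≤y (ℕ.s≤s⁻¹ y<1+n)) , ℕ.≤-refl)
...   | no ¬Q[1+n] = inj₂ λ x 1≤x x≤1+n →
  [ none x 1≤x ∘ ℕ.s≤s⁻¹ , (λ { refl → ¬Q[1+n] }) ]′ (ℕ.m≤n⇒m<n∨m≡n x≤1+n)

module LpBounds where

  open import Data.Nat using (_+_; _*_)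

  prime⇒∤ : ∀ {p d} → Prime p → .{{NonTrivial d}} → d < p → ¬ d ∣ p
  prime⇒∤ p-prime d<p d∣p = Prime.notComposite p-prime (composite d<p d∣p)

  odd⇒≡1+2q : ∀ {n} → ¬ 2 ∣ n → n ≡ suc (n / 2 + n / 2)
  odd⇒≡1+2q {n} 2∤n with n % 2 in n%2≡r | ℕ.m%n<n n 2
  ... | 0 | _ = ⊥-elim (2∤n (ℕ.m%n≡0⇒n∣m n 2 n%2≡r))
  ... | 1 | _ = begin
    n                     ≡⟨ ℕ.m≡m%n+[m/n]*n n 2 ⟩
    n % 2 + n / 2 * 2     ≡⟨ cong (λ r → r + n / 2 * 2) n%2≡r ⟩
    suc (n / 2 * 2)       ≡⟨ cong suc (ℕ.*-comm (n / 2) 2) ⟩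
    suc (2 * (n / 2))     ≡⟨ cong (λ m → suc (n / 2 + m)) (ℕ.+-identityʳ (n / 2)) ⟩
    suc (n / 2 + n / 2)   ∎
    where open ≡-Reasoning
  ... | suc (suc _) | s≤s (s≤s ())

  module _ {d : ℕ} (d∣12 : d ∣ 12) {n r : ℕ} (k : ℕ) (n≡r+12k : n ≡ r + k * 12) where

    ∣⇒∣residue : d ∣ n → d ∣ r
    ∣⇒∣residue d∣n = ℕ.∣m+n∣m⇒∣n (subst (d ∣_) (trans n≡r+12k (ℕ.+-comm r _)) d∣n)
                                    (ℕ.∣-trans d∣12 (ℕ.n∣m*n k))

    ∣residue⇒∣ : d ∣ r → d ∣ n
    ∣residue⇒∣ d∣r =
      subst (d ∣_) (sym n≡r+12k) (ℕ.∣m∣n⇒∣m+n d∣r (ℕ.∣-trans d∣12 (ℕ.n∣m*n k)))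

  module _ {p : ℕ} where

    private
      k = p / 12

      decompose : ∀ {r} → p % 12 ≡ r → p ≡ r + k * 12
      decompose refl = ℕ.m≡m%n+[m/n]*n p 12

      shift : ∀ c {r} → p % 12 ≡ r → p + c ≡ (r + c) + k * 12
      shift c {r} p%12≡r = trans (cong (_+ c) (decompose p%12≡r)) (reorder r c k)
        where
        reorder : ∀ r c k → r + k * 12 + c ≡ r + c + k * 12
        reorder = ℕ-Solver.solve-∀

      4∣12 : 4 ∣ 12
      4∣12 = divides 3 refl

      ∣residue⇒∣p : ∀ {d r} → d ∣ 12 → p % 12 ≡ r → d ∣ r → d ∣ p
      ∣residue⇒∣p d∣12 p%12≡r = ∣residue⇒∣ d∣12 k (decompose p%12≡r)

      Lp≡[p+3]/4 : p % 12 ≡ 1 → Lp p ≡ (p + 3) / 4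
      Lp≡[p+3]/4 p%12≡1 with p % 12 | p%12≡1
      ... | .1 | refl = refl

      Lp≡[p∸1]/4 : p % 12 ≡ 5 → Lp p ≡ (p ∸ 1) / 4
      Lp≡[p∸1]/4 p%12≡5 with p % 12 | p%12≡5
      ... | .5 | refl = refl

      Lp≡[p+5]/4 : p % 12 ≡ 7 → Lp p ≡ (p + 5) / 4
      Lp≡[p+5]/4 p%12≡7 with p % 12 | p%12≡7
      ... | .7 | refl = refl

      Lp≡[p+1]/4 : p % 12 ≡ 11 → Lp p ≡ (p + 1) / 4
      Lp≡[p+1]/4 p%12≡11 with p % 12 | p%12≡11
      ... | .11 | refl = refl

      4*Lp≡ : ∀ {n r} → Lp p ≡ n / 4 → n ≡ r + k * 12 → 4 ∣ r → 4 * Lp p ≡ n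
      4*Lp≡ Lp≡ n≡ 4∣r = trans (cong (4 *_) Lp≡) (ℕ.m*[n/m]≡n (∣residue⇒∣ 4∣12 k n≡ 4∣r))

    unit-residue : ¬ 2 ∣ p → ¬ 3 ∣ p → p % 12 ≡ 1 ⊎ p % 12 ≡ 5 ⊎ p % 12 ≡ 7 ⊎ p % 12 ≡ 11
    unit-residue 2∤p 3∤p with p % 12 in p%12≡r | ℕ.m%n<n p 12
    ... | 0  | _ = ⊥-elim (2∤p (∣residue⇒∣p (divides 6 refl) p%12≡r (divides 0 refl)))
    ... | 1  | _ = inj₁ refl
    ... | 2  | _ = ⊥-elim (2∤p (∣residue⇒∣p (divides 6 refl) p%12≡r (divides 1 refl)))
    ... | 3  | _ = ⊥-elim (3∤p (∣residue⇒∣p (divides 4 refl) p%12≡r (divides 1 refl)))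
    ... | 4  | _ = ⊥-elim (2∤p (∣residue⇒∣p (divides 6 refl) p%12≡r (divides 2 refl)))
    ... | 5  | _ = inj₂ (inj₁ refl)
    ... | 6  | _ = ⊥-elim (2∤p (∣residue⇒∣p (divides 6 refl) p%12≡r (divides 3 refl)))
    ... | 7  | _ = inj₂ (inj₂ (inj₁ refl))
    ... | 8  | _ = ⊥-elim (2∤p (∣residue⇒∣p (divides 6 refl) p%12≡r (divides 4 refl)))
    ... | 9  | _ = ⊥-elim (3∤p (∣residue⇒∣p (divides 4 refl) p%12≡r (divides 3 refl)))
    ... | 10 | _ = ⊥-elim (2∤p (∣residue⇒∣p (divides 6 refl) p%12≡r (divides 5 refl)))
    ... | 11 | _ = inj₂ (inj₂ (inj₂ refl))
    ... | suc (suc (suc (suc (suc (suc (suc (suc (suc (suc (suc (suc _))))))))))) | 12+r<12 =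
      ⊥-elim (ℕ.<⇒≱ 12+r<12 (ℕ.m≤m+n 12 _))

    private
      p∸1≡ : ∀ {r} → p % 12 ≡ suc r → p ∸ 1 ≡ r + k * 12
      p∸1≡ p%12≡1+r = cong (_∸ 1) (decompose p%12≡1+r)

      p+c≡4Lp⇒p≤4Lp+1 : ∀ {c} → p + c ≡ 4 * Lp p → p ≤ 4 * Lp p + 1
      p+c≡4Lp⇒p≤4Lp+1 {c} eq =
        ℕ.≤-trans (ℕ.m≤m+n p c) (ℕ.≤-trans (ℕ.≤-reflexive eq) (ℕ.m≤m+n _ 1))

    Lp-lower-bound : ¬ 2 ∣ p → ¬ 3 ∣ p → p ≤ 4 * Lp p + 1
    Lp-lower-bound 2∤p 3∤p with unit-residue 2∤p 3∤p
    ... | inj₁ p%12≡1 =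
      p+c≡4Lp⇒p≤4Lp+1 (sym (4*Lp≡ (Lp≡[p+3]/4 p%12≡1) (shift 3 p%12≡1) (divides 1 refl)))
    ... | inj₂ (inj₁ p%12≡5) = ℕ.≤-reflexive (trans
            (sym (ℕ.m∸n+n≡m (subst (1 ≤_) (sym (decompose p%12≡5)) (s≤s z≤n))))
            (cong (_+ 1) (sym (4*Lp≡ (Lp≡[p∸1]/4 p%12≡5) (p∸1≡ p%12≡5) (divides 1 refl)))))
    ... | inj₂ (inj₂ (inj₁ p%12≡7)) =
      p+c≡4Lp⇒p≤4Lp+1 (sym (4*Lp≡ (Lp≡[p+5]/4 p%12≡7) (shift 5 p%12≡7) (divides 3 refl)))
    ... | inj₂ (inj₂ (inj₂ p%12≡11)) =
      p+c≡4Lp⇒p≤4Lp+1 (sym (4*Lp≡ (Lp≡[p+1]/4 p%12≡11) (shift 1 p%12≡11) (divides 3 refl)))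

    Lp-lower-bound-1mod3 : ¬ 2 ∣ p → ¬ 3 ∣ p → 3 ∣ p ∸ 1 → p + 3 ≤ 4 * Lp p
    Lp-lower-bound-1mod3 2∤p 3∤p 3∣p-1 with unit-residue 2∤p 3∤p
    ... | inj₁ p%12≡1 = ℕ.≤-reflexive
            (sym (4*Lp≡ (Lp≡[p+3]/4 p%12≡1) (shift 3 p%12≡1) (divides 1 refl)))
    ... | inj₂ (inj₁ p%12≡5) =
      ⊥-elim (from-no (3 ∣? 4) (∣⇒∣residue (divides 4 refl) k (p∸1≡ p%12≡5) 3∣p-1))
    ... | inj₂ (inj₂ (inj₁ p%12≡7)) = ℕ.≤-trans (ℕ.+-monoʳ-≤ p (ℕ.m≤m+n 3 2)) (ℕ.≤-reflexive
            (sym (4*Lp≡ (Lp≡[p+5]/4 p%12≡7) (shift 5 p%12≡7) (divides 3 refl))))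
    ... | inj₂ (inj₂ (inj₂ p%12≡11)) =
      ⊥-elim (from-no (3 ∣? 10) (∣⇒∣residue (divides 4 refl) k (p∸1≡ p%12≡11) 3∣p-1))

  private
    sum-contradiction : ∀ {a b c d} k → a ≤ b → c ≤ d → a + c ≡ suc k + (b + d) → ⊥
    sum-contradiction {a} {b} {c} {d} k a≤b c≤d eq =
      ℕ.<⇒≱ (subst (b + d <_) (sym eq) (ℕ.m<n+m (b + d) {suc k} (s≤s z≤n))) (ℕ.+-mono-≤ a≤b c≤d)

  conic-bound-contradiction : ∀ {p q L} → p ≡ suc (q + q) → p ≤ 4 * L + 1 → p + 1 ≤ (q ∸ L) * 4 → ⊥
  conic-bound-contradiction {p} {q} {L} p≡ p≤4L+1 p+1≤ with L ℕ.≤? q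
  ... | no L≰q
    with () ← ℕ.≤-trans (ℕ.m≤n+m 1 p)
                (subst (λ m → p + 1 ≤ m * 4) (ℕ.m≤n⇒m∸n≡0 (ℕ.<⇒≤ (ℕ.≰⇒> L≰q))) p+1≤)
  ... | yes L≤q with d , refl ← ℕ.m≤n⇒∃[o]m+o≡n L≤q | refl ← p≡ =
    sum-contradiction 1 p≤4L+1 (subst (λ m → p + 1 ≤ m * 4) (ℕ.m+n∸m≡n L d) p+1≤) (arith L d)
    where
    arith : ∀ L d → suc ((L + d) + (L + d)) + (suc ((L + d) + (L + d)) + 1) ≡ 2 + (4 * L + 1 + d * 4)
    arith = ℕ-Solver.solve-∀

  conic-bound-contradiction-1mod3 : ∀ {p q L} → p ≡ suc (q + q) → 5 ≤ p → p + 3 ≤ 4 * L →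
                                    q + q ≤ (q ∸ L) * 4 + 2 → ⊥
  conic-bound-contradiction-1mod3 {p} {q} {L} p≡ 5≤p p+3≤4L 2q≤ with L ℕ.≤? q
  ... | no L≰q = ℕ.<⇒≱ {2} {4} (s≤s (s≤s (s≤s z≤n)))
                   (ℕ.≤-trans (ℕ.s≤s⁻¹ (subst (5 ≤_) p≡ 5≤p))
                   (subst (λ m → q + q ≤ m * 4 + 2) (ℕ.m≤n⇒m∸n≡0 (ℕ.<⇒≤ (ℕ.≰⇒> L≰q))) 2q≤))
  ... | yes L≤q with d , refl ← ℕ.m≤n⇒∃[o]m+o≡n L≤q | refl ← p≡ =
    sum-contradiction 1 p+3≤4L (subst (λ m → (L + d) + (L + d) ≤ m * 4 + 2) (ℕ.m+n∸m≡n L d) 2q≤)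
      (arith L d)
    where
    arith : ∀ L d → suc ((L + d) + (L + d)) + 3 + ((L + d) + (L + d)) ≡ 2 + (4 * L + (d * 4 + 2))
    arith = ℕ-Solver.solve-∀

open import Data.Integer using (_+_; _*_; -_; _-_)

module Congruence (m : ℤ) where

  infix 4 _≈_ _≉_

  data _≈_ (a b : ℤ) : Set where
    ≈-by : (k : ℤ) → a ≡ b + k * m → a ≈ b

  _≉_ : ℤ → ℤ → Set
  a ≉ b = ¬ (a ≈ b)

  ≈-reflexive : ∀ {a b} → a ≡ b → a ≈ b
  ≈-reflexive {b = b} refl = ≈-by 0ℤ (solve (b ∷ m ∷ []))

  ≈-refl : ∀ {a} → a ≈ a
  ≈-refl = ≈-reflexive refl

  ≈-sym : ∀ {a b} → a ≈ b → b ≈ a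
  ≈-sym {b = b} (≈-by k refl) = ≈-by (- k) (solve (b ∷ k ∷ m ∷ []))

  ≈-trans : ∀ {a b c} → a ≈ b → b ≈ c → a ≈ c
  ≈-trans {c = c} (≈-by k refl) (≈-by l refl) = ≈-by (k + l) (solve (c ∷ k ∷ l ∷ m ∷ []))

  ≈-setoid : Setoid _ _
  ≈-setoid = record
    { Carrier = ℤ ; _≈_ = _≈_
    ; isEquivalence = record { refl = ≈-refl ; sym = ≈-sym ; trans = ≈-trans } }

  module ≈-Reasoning = Relation.Binary.Reasoning.Setoid ≈-setoid

  +-cong : ∀ {a b c d} → a ≈ b → c ≈ d → a + c ≈ b + d
  +-cong {b = b} {d = d} (≈-by k refl) (≈-by l refl) =
    ≈-by (k + l) (solve (b ∷ d ∷ k ∷ l ∷ m ∷ []))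

  *-cong : ∀ {a b c d} → a ≈ b → c ≈ d → a * c ≈ b * d
  *-cong {b = b} {d = d} (≈-by k refl) (≈-by l refl) =
    ≈-by (k * d + b * l + k * l * m) (solve (b ∷ d ∷ k ∷ l ∷ m ∷ []))

  -‿cong : ∀ {a b} → a ≈ b → - a ≈ - b
  -‿cong {b = b} (≈-by k refl) = ≈-by (- k) (solve (b ∷ k ∷ m ∷ []))

  -‿injective : ∀ {a b} → - a ≈ - b → a ≈ b
  -‿injective {a} {b} -a≈-b =
    ≈-trans (≈-reflexive (sym (ℤ.neg-involutive a)))
            (≈-trans (-‿cong -a≈-b) (≈-reflexive (ℤ.neg-involutive b)))

  m≈0 : m ≈ 0ℤ
  m≈0 = ≈-by 1ℤ (solve (m ∷ []))

  ≈⇒-≈0 : ∀ {a b} → a ≈ b → a - b ≈ 0ℤ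
  ≈⇒-≈0 {a} {b} a≈b = begin
    a - b  ≈⟨ +-cong a≈b ≈-refl ⟩
    b - b  ≡⟨ ℤ.+-inverseʳ b ⟩
    0ℤ     ∎
    where open ≈-Reasoning

  -≈0⇒≈ : ∀ {a b} → a - b ≈ 0ℤ → a ≈ b
  -≈0⇒≈ {a} {b} a-b≈0 = begin
    a            ≡⟨ solve (a ∷ b ∷ []) ⟩
    (a - b) + b  ≈⟨ +-cong a-b≈0 ≈-refl ⟩
    0ℤ + b       ≡⟨ ℤ.+-identityˡ b ⟩
    b            ∎
    where open ≈-Reasoning

  +-cancelˡ : ∀ {c a b} → c + a ≈ c + b → a ≈ b
  +-cancelˡ {c} {a} {b} eq = begin
    a              ≡⟨ solve (a ∷ c ∷ []) ⟩
    - c + (c + a)  ≈⟨ +-cong (≈-refl { - c}) eq ⟩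
    - c + (c + b)  ≡⟨ solve (b ∷ c ∷ []) ⟨
    b              ∎
    where open ≈-Reasoning

  ∣⇒≈0 : ∀ {a} → m ℤ.∣ a → a ≈ 0ℤ
  ∣⇒≈0 (ℤ.divides k a≡km) = ≈-by k (trans a≡km (sym (ℤ.+-identityˡ _)))

  ≈0⇒∣ : ∀ {a} → a ≈ 0ℤ → m ℤ.∣ a
  ≈0⇒∣ (≈-by k a≡0+km) = ℤ.divides k (trans a≡0+km (ℤ.+-identityˡ _))

  bézout-+-⇒inverse : ∀ {r y x} → 1ℤ + y * r ≡ x * m → r * - y ≈ 1ℤ
  bézout-+-⇒inverse {r} {y} {x} eq = ≈-by (- x) (begin
    r * - y             ≡⟨ solve (r ∷ y ∷ []) ⟩
    1ℤ - (1ℤ + y * r)   ≡⟨ cong (λ z → 1ℤ - z) eq ⟩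
    1ℤ - x * m          ≡⟨ solve (x ∷ m ∷ []) ⟩
    1ℤ + (- x) * m      ∎)
    where open ≡-Reasoning

  bézout-+⇒inverse : ∀ {r y x} → 1ℤ + x * m ≡ y * r → r * y ≈ 1ℤ
  bézout-+⇒inverse {r} {y} {x} eq = ≈-by x (trans (ℤ.*-comm r y) (sym eq))

  ω²+ω+1≈0 : ∀ {h s} → + 2 * h ≈ 1ℤ → s * s ≈ - + 3 →
              let ω = h * (s - 1ℤ) in ω * ω + ω + 1ℤ ≈ 0ℤ
  ω²+ω+1≈0 {h} {s} 2h≈1 s²≈-3 = begin
    h * (s - 1ℤ) * (h * (s - 1ℤ)) + h * (s - 1ℤ) + 1ℤ
      ≡⟨ solve (h ∷ s ∷ []) ⟩
    h * h * (s * s + + 3) - (h * s + h + 1ℤ) * (+ 2 * h - 1ℤ)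
      ≈⟨ +-cong (*-cong (≈-refl {h * h}) s²+3≈0)
                (-‿cong (*-cong (≈-refl {h * s + h + 1ℤ}) (≈⇒-≈0 2h≈1))) ⟩
    h * h * 0ℤ - (h * s + h + 1ℤ) * 0ℤ
      ≡⟨ solve (h ∷ s ∷ []) ⟩
    0ℤ ∎
    where
    open ≈-Reasoning
    s²+3≈0 : s * s + + 3 ≈ 0ℤ
    s²+3≈0 = ≈-trans (+-cong s²≈-3 ≈-refl) (≈-reflexive (ℤ.+-inverseˡ (+ 3)))

  ω²+ω+1≈0⇒ω³≈1 : ∀ {ω} → ω * ω + ω + 1ℤ ≈ 0ℤ → ω * ω * ω ≈ 1ℤ
  ω²+ω+1≈0⇒ω³≈1 {ω} ω²+ω+1≈0 = begin
    ω * ω * ω                            ≡⟨ solve (ω ∷ []) ⟩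
    (ω - 1ℤ) * (ω * ω + ω + 1ℤ) + 1ℤ     ≈⟨ +-cong (*-cong (≈-refl {ω - 1ℤ}) ω²+ω+1≈0) ≈-refl ⟩
    (ω - 1ℤ) * 0ℤ + 1ℤ                   ≡⟨ solve (ω ∷ []) ⟩
    1ℤ                                   ∎
    where open ≈-Reasoning

module Residues (n : ℕ) .{{_ : NonZero n}} where

  open Congruence (+ n)

  private
    lift : ∀ {i j k l} → 1 ℕ.+ i ℕ.* j ≡ k ℕ.* l → 1ℤ + + i * + j ≡ + k * + l
    lift {i} {j} {k} {l} eq =
      trans (cong (λ z → 1ℤ + z) (sym (ℤ.pos-* i j))) (trans (cong +_ eq) (ℤ.pos-* k l))

  ≈-%ℕ : ∀ a → a ≈ + (a %ℕ n)
  ≈-%ℕ a = ≈-by (a /ℕ n) (a≡a%ℕn+[a/ℕn]*n a n)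

  ≈-%ℕ≡ : ∀ {a r} → a %ℕ n ≡ r → a ≈ + r
  ≈-%ℕ≡ {a} refl = ≈-%ℕ a

  ℕ∣⇒≈0 : ∀ {a} → n ∣ ∣ a ∣ → a ≈ 0ℤ
  ℕ∣⇒≈0 n∣a = ∣⇒≈0 (ℤ.∣ᵤ⇒∣ n∣a)

  ≈0⇒ℕ∣ : ∀ {a} → a ≈ 0ℤ → n ∣ ∣ a ∣
  ≈0⇒ℕ∣ a≈0 = ℤ.∣⇒∣ᵤ (≈0⇒∣ a≈0)

  reduced-≈⇒≡ : ∀ {i j} → i < n → j < n → + i ≈ + j → i ≡ j
  reduced-≈⇒≡ {i} {j} i<n j<n i≈j =
    ℤ.+-injective (ℤ.i-j≡0⇒i≡j (+ i) (+ j) (ℤ.∣i∣≡0⇒i≡0 ∣i-j∣≡0))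
    where
    ∣i-j∣<n : ∣ + i - + j ∣ < n
    ∣i-j∣<n = subst (_< n) (cong ∣_∣ (sym (ℤ.[+m]-[+n]≡m⊖n i j)))
                (ℕ.≤-<-trans (ℤ.∣m⊝n∣≤m⊔n i j) (ℕ.⊔-lub i<n j<n))
    ∣i-j∣≡0 : ∣ + i - + j ∣ ≡ 0
    ∣i-j∣≡0 = trans (sym (ℕ.m<n⇒m%n≡m ∣i-j∣<n)) (ℕ.n∣m⇒m%n≡0 _ n (≈0⇒ℕ∣ (≈⇒-≈0 i≈j)))

  %ℕ-cong : ∀ {a b} → a ≈ b → a %ℕ n ≡ b %ℕ n
  %ℕ-cong {a} {b} a≈b = reduced-≈⇒≡ (n%ℕd<d a n) (n%ℕd<d b n)
    (≈-trans (≈-sym (≈-%ℕ a)) (≈-trans a≈b (≈-%ℕ b)))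

  %ℕ-injective : ∀ {a b} → a %ℕ n ≡ b %ℕ n → a ≈ b
  %ℕ-injective {a} {b} eq = ≈-trans (≈-%ℕ a) (≈-trans (≈-reflexive (cong +_ eq)) (≈-sym (≈-%ℕ b)))

  residue : ℤ → Fin n
  residue a = fromℕ< (n%ℕd<d a n)

  residue-injective : ∀ {a b} → residue a ≡ residue b → a ≈ b
  residue-injective {a} {b} eq = %ℕ-injective (Fin.fromℕ<-injective _ _ (n%ℕd<d a n) (n%ℕd<d b n) eq)

  bézout⇒invertible : ∀ {r} → Bézout.Identity 1 n r → ∃ λ b → + r * b ≈ 1ℤ
  bézout⇒invertible {r} (Bézout.+- x y eq) = - + y , bézout-+-⇒inverse {+ r} {+ y} {+ x} (lift {y} {r} {x} {n} eq)
  bézout⇒invertible {r} (Bézout.-+ x y eq) = + y , bézout-+⇒inverse {+ r} {+ y} {+ x} (lift {x} {n} {y} {r} eq)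

  infix 4 _≈?_
  _≈?_ : ∀ a b → Dec (a ≈ b)
  a ≈? b with a %ℕ n ℕ.≟ b %ℕ n
  ... | yes eq = yes (%ℕ-injective eq)
  ... | no neq = no (λ a≈b → neq (%ℕ-cong a≈b))

module PrimeField (p : ℕ) (p-prime : Prime p) where

  instance
    p≢0 : NonZero p
    p≢0 = prime⇒nonZero p-prime

  open Congruence (+ p) public
  open Residues p public

  x*y≈0⇒x≈0⊎y≈0 : ∀ {a b} → a * b ≈ 0ℤ → a ≈ 0ℤ ⊎ b ≈ 0ℤ
  x*y≈0⇒x≈0⊎y≈0 {a} {b} ab≈0 with euclidsLemma ∣ a ∣ ∣ b ∣ p-prime p∣∣a∣∣b∣
    where p∣∣a∣∣b∣ = subst (p ∣_) (ℤ.abs-* a b) (≈0⇒ℕ∣ {a * b} ab≈0)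
  ... | inj₁ p∣a = inj₁ (ℕ∣⇒≈0 p∣a)
  ... | inj₂ p∣b = inj₂ (ℕ∣⇒≈0 p∣b)

  *-≉0 : ∀ {a b} → a ≉ 0ℤ → b ≉ 0ℤ → a * b ≉ 0ℤ
  *-≉0 {a} a≉0 b≉0 ab≈0 = [ a≉0 , b≉0 ]′ (x*y≈0⇒x≈0⊎y≈0 {a} ab≈0)

  <p⇒≉0 : ∀ {i} → 0 < i → i < p → + i ≉ 0ℤ
  <p⇒≉0 {suc i} _ i<p i≈0 with () ← reduced-≈⇒≡ i<p (ℕ.<-trans (s≤s z≤n) i<p) i≈0

  ≉0⇒invertible : ∀ {a} → a ≉ 0ℤ → ∃ λ b → a * b ≈ 1ℤ
  ≉0⇒invertible {a} a≉0 with a %ℕ p in a%p≡r | n%ℕd<d a p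
  ... | zero      | _   = ⊥-elim (a≉0 (≈-%ℕ≡ {a} a%p≡r))
  ... | r@(suc _) | r<p with b , rb≈1 ← bézout⇒invertible (coprime-Bézout (prime⇒coprime p-prime r<p)) =
    b , ≈-trans (*-cong (≈-%ℕ≡ {a} a%p≡r) ≈-refl) rb≈1

  difference-of-squares : ∀ {x y} → x * x ≈ y * y → (x - y) * (x + y) ≈ 0ℤ
  difference-of-squares {x} {y} x²≈y² = begin
    (x - y) * (x + y)  ≡⟨ solve (x ∷ y ∷ []) ⟩
    x * x - y * y      ≈⟨ ≈⇒-≈0 x²≈y² ⟩
    0ℤ                 ∎
    where open ≈-Reasoning

  x*x≈y*y⇒x≈y⊎x≈-y : ∀ {x y} → x * x ≈ y * y → x ≈ y ⊎ x ≈ - y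
  x*x≈y*y⇒x≈y⊎x≈-y {x} {y} x²≈y² =
    Sum.map -≈0⇒≈ (λ x+y≈0 → -≈0⇒≈ (≈-trans (≈-reflexive x--y≡x+y) x+y≈0))
            (x*y≈0⇒x≈0⊎y≈0 {x - y} (difference-of-squares {x} {y} x²≈y²))
    where
    x--y≡x+y : x - - y ≡ x + y
    x--y≡x+y = cong (λ z → x + z) (ℤ.neg-involutive y)

  ≉0⇒%ℕ-positive : ∀ {a} → a ≉ 0ℤ → 0 < a %ℕ p
  ≉0⇒%ℕ-positive {a} a≉0 with a %ℕ p in a%p≡r
  ... | zero  = ⊥-elim (a≉0 (≈-%ℕ≡ {a} a%p≡r))
  ... | suc _ = s≤s z≤n

  *-cancelˡ : ∀ {c a b} → c ≉ 0ℤ → c * a ≈ c * b → a ≈ b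
  *-cancelˡ {c} {a} {b} c≉0 ca≈cb =
    [ (λ c≈0 → ⊥-elim (c≉0 c≈0)) , -≈0⇒≈ ]′ (x*y≈0⇒x≈0⊎y≈0 {c} (begin
      c * (a - b)     ≡⟨ ℤ.*-distribˡ-+ c a (- b) ⟩
      c * a + c * - b ≡⟨ cong (λ z → c * a + z) (sym (ℤ.neg-distribʳ-* c b)) ⟩
      c * a - c * b   ≈⟨ ≈⇒-≈0 ca≈cb ⟩
      0ℤ              ∎))
    where open ≈-Reasoning

  IsSquare : ℤ → Set
  IsSquare a = ∃ λ y → y * y ≈ a

  square? : ∀ a → Dec (IsSquare a)
  square? a with Fin.any? (λ (y : Fin p) → + toℕ y * + toℕ y ≈? a)
  ... | yes (y , y²≈a) = yes (+ toℕ y , y²≈a)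
  ... | no ¬reduced = no λ (y , y²≈a) → ¬reduced (fromℕ< (n%ℕd<d y p) , ≈-trans
          (≈-reflexive (cong (λ r → + r * + r) (Fin.toℕ-fromℕ< (n%ℕd<d y p))))
          (≈-trans (*-cong (≈-sym (≈-%ℕ y)) (≈-sym (≈-%ℕ y))) y²≈a))

  legendre⇔square : ∀ a → LegendreIn01 p a ⇔ IsSquare a
  legendre⇔square a = mk⇔
    (λ (y , p∣y²-a) → y , -≈0⇒≈ (ℕ∣⇒≈0 p∣y²-a))
    (λ (y , y²≈a) → y , ≈0⇒ℕ∣ (≈⇒-≈0 y²≈a))

  legendre? : ∀ a → Dec (LegendreIn01 p a)
  legendre? a = Dec.map′ (Equivalence.from (legendre⇔square a)) (Equivalence.to (legendre⇔square a)) (square? a)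

module HalfResidues (p : ℕ) (p-prime : Prime p) (q : ℕ) (p≡2q+1 : p ≡ suc (q ℕ.+ q)) where

  open PrimeField p p-prime

  upper : ℕ → Bool
  upper r = ⌊ q <? r ⌋

  ≤q⇒¬upper : ∀ {r} → r ≤ q → upper r ≡ false
  ≤q⇒¬upper {r} r≤q with q <? r
  ... | yes q<r = ⊥-elim (ℕ.<⇒≱ q<r r≤q)
  ... | no _    = refl

  private
    i≈-j⇒i+j≡0⊎i+j≡p : ∀ {i j} → i < p → j < p → + i ≈ - + j → i ℕ.+ j ≡ 0 ⊎ i ℕ.+ j ≡ p
    i≈-j⇒i+j≡0⊎i+j≡p {i} {j} i<p j<p i≈-j
      with ≈0⇒ℕ∣ {+ i + + j} (≈-trans (+-cong i≈-j ≈-refl) (≈-reflexive (ℤ.+-inverseˡ (+ j))))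
    ... | divides 0 i+j≡0 = inj₁ i+j≡0
    ... | divides 1 i+j≡p = inj₂ (trans i+j≡p (ℕ.+-identityʳ p))
    ... | divides (suc (suc k)) i+j≡kp = ⊥-elim (ℕ.<⇒≱ (ℕ.+-mono-< i<p j<p)
            (subst (p ℕ.+ p ≤_) (sym i+j≡kp) (ℕ.+-monoʳ-≤ p (ℕ.m≤m+n p (k ℕ.* p)))))

    complementary-halves : ∀ {i j} → i ℕ.+ j ≡ p → upper i ≡ not (upper j)
    complementary-halves {i} {j} i+j≡p with q <? i | q <? j
    ... | yes q<i | yes q<j = ⊥-elim (ℕ.<-irrefl refl (begin-strict
          p                  ≡⟨ p≡2q+1 ⟩
          suc (q ℕ.+ q)      <⟨ ℕ.+-monoʳ-< (suc q) q<j ⟩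
          suc q ℕ.+ j        ≤⟨ ℕ.+-monoˡ-≤ j q<i ⟩
          i ℕ.+ j            ≡⟨ i+j≡p ⟩
          p                  ∎))
      where open ℕ.≤-Reasoning
    ... | yes _   | no _    = refl
    ... | no _    | yes _   = refl
    ... | no q≮i  | no q≮j  = ⊥-elim (ℕ.<-irrefl refl (begin-strict
          p                  ≡⟨ i+j≡p ⟨
          i ℕ.+ j            ≤⟨ ℕ.+-mono-≤ (ℕ.≮⇒≥ q≮i) (ℕ.≮⇒≥ q≮j) ⟩
          q ℕ.+ q            <⟨ ℕ.n<1+n _ ⟩
          suc (q ℕ.+ q)      ≡⟨ p≡2q+1 ⟨
          p                  ∎))
      where open ℕ.≤-Reasoning

  ≡-from-square-and-half : ∀ {i j} → i < p → j < p → + i * + i ≈ + j * + j → upper i ≡ upper j → i ≡ j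
  ≡-from-square-and-half {i} {j} i<p j<p i²≈j² same-half =
    [ reduced-≈⇒≡ i<p j<p , opposite ]′ (x*x≈y*y⇒x≈y⊎x≈-y i²≈j²)
    where
    opposite : + i ≈ - + j → i ≡ j
    opposite i≈-j with i≈-j⇒i+j≡0⊎i+j≡p i<p j<p i≈-j
    ... | inj₁ i+j≡0 = trans (ℕ.m+n≡0⇒m≡0 i i+j≡0) (sym (ℕ.m+n≡0⇒n≡0 i i+j≡0))
    ... | inj₂ i+j≡p = ⊥-elim (not-¬ same-half (complementary-halves i+j≡p))

  fold : ℕ → ℕ
  fold r = if upper r then p ∸ r else r

  fold≤q : ∀ {r} → r < p → fold r ≤ q
  fold≤q {r} r<p with q <? r
  ... | yes q<r = ℕ.≤-trans (ℕ.∸-monoʳ-≤ p q<r)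
                    (ℕ.≤-reflexive (trans (cong (ℕ._∸ suc q) p≡2q+1) (ℕ.m+n∸n≡m q q)))
  ... | no q≮r = ℕ.≮⇒≥ q≮r

  fold-positive : ∀ {r} → 0 < r → r < p → 0 < fold r
  fold-positive {r} 0<r r<p with q <? r
  ... | yes _ = ℕ.m<n⇒0<n∸m r<p
  ... | no _ = 0<r

  fold-square : ∀ {r} → r < p → + fold r * + fold r ≈ + r * + r
  fold-square {r} r<p with q <? r
  ... | yes _ = begin
        + (p ∸ r) * + (p ∸ r)  ≈⟨ *-cong p-r≈-r p-r≈-r ⟩
        - + r * - + r          ≡⟨ neg-square (+ r) ⟩
        + r * + r              ∎
    where
    open ≈-Reasoning
    neg-square : ∀ x → - x * - x ≡ x * x
    neg-square x = solve (x ∷ [])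
    p-r≈-r : + (p ∸ r) ≈ - + r
    p-r≈-r = begin
      + (p ∸ r)   ≡⟨ trans (ℤ.[+m]-[+n]≡m⊖n p r) (ℤ.⊖-≥ (ℕ.<⇒≤ r<p)) ⟨
      + p - + r   ≈⟨ +-cong m≈0 (≈-refl { - + r}) ⟩
      0ℤ - + r    ≡⟨ ℤ.+-identityˡ (- + r) ⟩
      - + r       ∎
  ... | no _ = ≈-refl

module LargePrime (p : ℕ) (p-prime : Prime p) (5≤p : 5 ≤ p) where

  open PrimeField p p-prime public

  2≉0 : + 2 ≉ 0ℤ
  2≉0 = <p⇒≉0 (s≤s z≤n) (ℕ.≤-trans (ℕ.m≤n+m 3 2) 5≤p)

  3≉0 : + 3 ≉ 0ℤ
  3≉0 = <p⇒≉0 (s≤s z≤n) (ℕ.≤-trans (ℕ.m≤n+m 4 1) 5≤p)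

module CubeRoots (p : ℕ) (p-prime : Prime p) (5≤p : 5 ≤ p) where

  open LargePrime p p-prime 5≤p
  open Counting

  unit : ℕ → Bool
  unit x = ⌊ x <? p ⌋ ∧ ⌊ 1 ≤? x ⌋

  unit-elim : ∀ {x} → unit x ≡ true → 0 < x × x < p
  unit-elim {x} ux with x <? p | 1 ≤? x
  ... | yes x<p | yes 0<x = 0<x , x<p

  unit-intro : ∀ {x} → 0 < x → x < p → unit x ≡ true
  unit-intro {x} 0<x x<p with x <? p | 1 ≤? x
  ... | yes _   | yes _   = refl
  ... | no x≮p  | _       = ⊥-elim (x≮p x<p)
  ... | yes _   | no 0≮x  = ⊥-elim (0≮x 0<x)

  count-units : count unit p ≡ p ∸ 1
  count-units = trans (count-cong p unit≡positive) (count-positive p)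
    where
    unit≡positive : ∀ {x} → x < p → unit x ≡ ⌊ 1 ≤? x ⌋
    unit≡positive {x} x<p with x <? p
    ... | yes _   = refl
    ... | no x≮p = ⊥-elim (x≮p x<p)

  module _ {ω : ℤ} (ω-root : ω * ω + ω + 1ℤ ≈ 0ℤ) where

    private
      root-at : ∀ {c} → ω ≈ c → c * c + c + 1ℤ ≈ 0ℤ
      root-at ω≈c = ≈-trans (+-cong (+-cong (*-cong (≈-sym ω≈c) (≈-sym ω≈c)) (≈-sym ω≈c)) ≈-refl) ω-root

      ω≉1 : ω ≉ 1ℤ
      ω≉1 ω≈1 = 3≉0 (root-at ω≈1)

      ω≉0 : ω ≉ 0ℤ
      ω≉0 ω≈0 = <p⇒≉0 (s≤s z≤n) (ℕ.≤-trans (s≤s (s≤s z≤n)) 5≤p) (root-at ω≈0)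

      σ : ℕ → ℕ
      σ x = (ω * + x) %ℕ p

      σ≈ : ∀ x → + σ x ≈ ω * + x
      σ≈ x = ≈-sym (≈-%ℕ (ω * + x))

      σ³≈id : ∀ x → + σ (σ (σ x)) ≈ + x
      σ³≈id x = begin
        + σ (σ (σ x))              ≈⟨ σ≈ _ ⟩
        ω * + σ (σ x)              ≈⟨ *-cong (≈-refl {ω}) (σ≈ _) ⟩
        ω * (ω * + σ x)            ≈⟨ *-cong (≈-refl {ω}) (*-cong (≈-refl {ω}) (σ≈ x)) ⟩
        ω * (ω * (ω * + x))        ≡⟨ reassoc ω (+ x) ⟩
        ω * ω * ω * + x            ≈⟨ *-cong (ω²+ω+1≈0⇒ω³≈1 {ω} ω-root) ≈-refl ⟩
        1ℤ * + x                   ≡⟨ ℤ.*-identityˡ (+ x) ⟩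
        + x                        ∎
        where
        open ≈-Reasoning
        reassoc : ∀ w y → w * (w * (w * y)) ≡ w * w * w * y
        reassoc w y = solve (w ∷ y ∷ [])

      σx≡x⇒[ω-1]x≈0 : ∀ {x} → σ x ≡ x → (ω - 1ℤ) * + x ≈ 0ℤ
      σx≡x⇒[ω-1]x≈0 {x} σx≡x = begin
        (ω - 1ℤ) * + x    ≡⟨ distrib ω (+ x) ⟩
        ω * + x - + x     ≈⟨ ≈⇒-≈0 (≈-trans (≈-sym (σ≈ x)) (≈-reflexive (cong +_ σx≡x))) ⟩
        0ℤ                ∎
        where
        open ≈-Reasoning
        distrib : ∀ w y → (w - 1ℤ) * y ≡ w * y - y
        distrib w y = solve (w ∷ y ∷ [])

      unit≉0 : ∀ {x} → unit x ≡ true → + x ≉ 0ℤ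
      unit≉0 ux = <p⇒≉0 (proj₁ (unit-elim ux)) (proj₂ (unit-elim ux))

      action : FreeOrder3Action σ p unit
      action = record
        { bounded        = λ ux → proj₂ (unit-elim ux)
        ; closed         = λ {x} ux →
            unit-intro (≉0⇒%ℕ-positive {ω * + x} (*-≉0 ω≉0 (unit≉0 ux))) (n%ℕd<d (ω * + x) p)
        ; cubic          = λ {x} ux →
            reduced-≈⇒≡ (n%ℕd<d (ω * + σ (σ x)) p) (proj₂ (unit-elim ux)) (σ³≈id x)
        ; no-fixed-point = λ ux σx≡x →
            [ ω≉1 ∘ -≈0⇒≈ , unit≉0 ux ]′ (x*y≈0⇒x≈0⊎y≈0 (σx≡x⇒[ω-1]x≈0 σx≡x))
        }

    cube-root⇒3∣p-1 : 3 ∣ p ∸ 1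
    cube-root⇒3∣p-1 = subst (3 ∣_) count-units (3∣count action)

  -3-square⇒3∣p-1 : IsSquare (- + 3) → 3 ∣ p ∸ 1
  -3-square⇒3∣p-1 (s , s²≈-3) with h , 2h≈1 ← ≉0⇒invertible 2≉0 =
    cube-root⇒3∣p-1 {h * (s - 1ℤ)} (ω²+ω+1≈0 {h} {s} 2h≈1 s²≈-3)

module Conic (p : ℕ) (p-prime : Prime p) (5≤p : 5 ≤ p) (q : ℕ) (p≡2q+1 : p ≡ suc (q ℕ.+ q)) where

  open LargePrime p p-prime 5≤p
  open HalfResidues p p-prime q p≡2q+1
  open FiniteCardinality

  record Point : Set where
    constructor point
    field
      y u      : ℤ
      on-conic : y * y + + 3 * (u * u) ≈ - + 12

  open Point public

  infix 4 _≅_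
  _≅_ : Point → Point → Set
  P ≅ Q = y P ≈ y Q × u P ≈ u Q

  y²≈-12-3u² : ∀ P → y P * y P ≈ - + 12 - + 3 * (u P * u P)
  y²≈-12-3u² P = begin
    y P * y P                                            ≡⟨ shift (y P) (u P) ⟩
    (y P * y P + + 3 * (u P * u P)) - + 3 * (u P * u P)
      ≈⟨ +-cong (on-conic P) (≈-refl { - (+ 3 * (u P * u P))}) ⟩
    - + 12 - + 3 * (u P * u P)                           ∎
    where
    open ≈-Reasoning
    shift : ∀ a b → a * a ≡ (a * a + + 3 * (b * b)) - + 3 * (b * b)
    shift a b = solve (a ∷ b ∷ [])

  -12-3*-cong : ∀ {a b} → a ≈ b → - + 12 - + 3 * a ≈ - + 12 - + 3 * b
  -12-3*-cong a≈b = +-cong (≈-refl { - + 12}) (-‿cong (*-cong (≈-refl {+ 3}) a≈b))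

  y-determined : ∀ {P Q} → u P ≈ u Q → upper (y P %ℕ p) ≡ upper (y Q %ℕ p) → y P ≈ y Q
  y-determined {P} {Q} uP≈uQ same-half =
    %ℕ-injective (≡-from-square-and-half (n%ℕd<d (y P) p) (n%ℕd<d (y Q) p) squares same-half)
    where
    open ≈-Reasoning
    squares : + (y P %ℕ p) * + (y P %ℕ p) ≈ + (y Q %ℕ p) * + (y Q %ℕ p)
    squares = begin
      + (y P %ℕ p) * + (y P %ℕ p)   ≈⟨ *-cong (≈-sym (≈-%ℕ (y P))) (≈-sym (≈-%ℕ (y P))) ⟩
      y P * y P                     ≈⟨ y²≈-12-3u² P ⟩
      - + 12 - + 3 * (u P * u P)    ≈⟨ -12-3*-cong (*-cong uP≈uQ uP≈uQ) ⟩
      - + 12 - + 3 * (u Q * u Q)    ≈⟨ y²≈-12-3u² Q ⟨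
      y Q * y Q                     ≈⟨ *-cong (≈-%ℕ (y Q)) (≈-%ℕ (y Q)) ⟩
      + (y Q %ℕ p) * + (y Q %ℕ p)   ∎

  private
    lower-half-injective : ∀ {a b : Fin (suc q)} → + toℕ a * + toℕ a ≈ + toℕ b * + toℕ b → a ≡ b
    lower-half-injective {a} {b} a²≈b² = Fin.toℕ-injective (≡-from-square-and-half (<p a) (<p b) a²≈b²
      (trans (≤q⇒¬upper (ℕ.s≤s⁻¹ (Fin.toℕ<n a))) (sym (≤q⇒¬upper (ℕ.s≤s⁻¹ (Fin.toℕ<n b))))))
      where
      <p : ∀ (c : Fin (suc q)) → toℕ c < p
      <p c = ℕ.<-≤-trans (Fin.toℕ<n c) (subst (suc q ≤_) (sym p≡2q+1) (s≤s (ℕ.m≤m+n q q)))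

  -- Pigeonhole: the p + 1 values a² and −12 − 3b² with a, b ≤ q cannot be distinct mod p.
  some-point : Point
  some-point with Fin.any? (λ (a : Fin (suc q)) → Fin.any? (λ (b : Fin (suc q)) →
                    + toℕ a * + toℕ a ≈? - + 12 - + 3 * (+ toℕ b * + toℕ b)))
  ... | yes (a , b , a²≈-12-3b²) = point (+ toℕ a) (+ toℕ b) (begin
        + toℕ a * + toℕ a + 3b²             ≈⟨ +-cong a²≈-12-3b² (≈-refl {3b²}) ⟩
        - + 12 - 3b² + 3b²                  ≡⟨ cancel 3b² ⟩
        - + 12                              ∎)
    where
    open ≈-Reasoning
    3b² = + 3 * (+ toℕ b * + toℕ b)
    cancel : ∀ c → - + 12 - c + c ≡ - + 12
    cancel c = solve (c ∷ [])
  ... | no no-solution =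
    ⊥-elim (ℕ.<-irrefl refl
      (ℕ.≤-trans (subst (_≤ p) (cong suc (ℕ.+-suc q q)) 2+2q≤p) (ℕ.≤-reflexive p≡2q+1)))
    where
    value : Fin (suc q) ⊎ Fin (suc q) → Fin p
    value (inj₁ a) = residue (+ toℕ a * + toℕ a)
    value (inj₂ b) = residue (- + 12 - + 3 * (+ toℕ b * + toℕ b))
    value-injective : ∀ {c d} → value c ≡ value d → c ≡ d
    value-injective {inj₁ a} {inj₁ b} eq = cong inj₁ (lower-half-injective (residue-injective eq))
    value-injective {inj₂ a} {inj₂ b} eq = cong inj₂ (lower-half-injective
      (*-cancelˡ {+ 3} 3≉0 (-‿injective (+-cancelˡ { - + 12} (residue-injective eq)))))
    value-injective {inj₁ a} {inj₂ b} eq = ⊥-elim (no-solution (a , b , residue-injective eq))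
    value-injective {inj₂ a} {inj₁ b} eq = ⊥-elim (no-solution (b , a , ≈-sym (residue-injective eq)))
    2+2q≤p : suc q ℕ.+ suc q ≤ p
    2+2q≤p = injective⇒card≤ (↔-sym Fin.+↔⊎) ↔-refl value value-injective

  nonsquare⇒u≉0 : ¬ IsSquare (- + 3) → ∀ P → u P ≉ 0ℤ
  nonsquare⇒u≉0 ¬□ P u≈0 with h , 2h≈1 ← ≉0⇒invertible 2≉0 = ¬□ (y P * h , (begin
    (y P * h) * (y P * h)                    ≡⟨ rearrange (y P) h ⟩
    y P * y P * (h * h)                      ≈⟨ *-cong (y²≈-12-3u² P) (≈-refl {h * h}) ⟩
    (- + 12 - + 3 * (u P * u P)) * (h * h)   ≈⟨ *-cong (-12-3*-cong (*-cong u≈0 u≈0)) (≈-refl {h * h}) ⟩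
    (- + 12 - + 3 * (0ℤ * 0ℤ)) * (h * h)     ≡⟨ reshape h ⟩
    - + 3 * ((+ 2 * h) * (+ 2 * h))          ≈⟨ *-cong (≈-refl { - + 3}) (*-cong 2h≈1 2h≈1) ⟩
    - + 3                                    ∎))
    where
    open ≈-Reasoning
    rearrange : ∀ a b → (a * b) * (a * b) ≡ a * a * (b * b)
    rearrange a b = solve (a ∷ b ∷ [])
    reshape : ∀ h → (- + 12 - + 3 * (0ℤ * 0ℤ)) * (h * h) ≡ - + 3 * ((+ 2 * h) * (+ 2 * h))
    reshape h = solve (h ∷ [])

  module Lines (¬□ : ¬ IsSquare (- + 3)) (P₀ : Point) where

    private
      y₀ u₀ : ℤ
      y₀ = y P₀
      u₀ = u P₀

      u₀≉0 : u₀ ≉ 0ℤ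
      u₀≉0 = nonsquare⇒u≉0 ¬□ P₀

    D : ℕ → ℤ
    D m = 1ℤ + + 3 * (+ m * + m)

    D≉0 : ∀ m → D m ≉ 0ℤ
    D≉0 m D≈0 = ¬□ (+ 3 * + m , (begin
      (+ 3 * + m) * (+ 3 * + m)              ≡⟨ reshape (+ m) ⟩
      + 3 * (1ℤ + + 3 * (+ m * + m)) - + 3   ≈⟨ +-cong (*-cong (≈-refl {+ 3}) D≈0) (≈-refl { - + 3}) ⟩
      + 3 * 0ℤ - + 3                         ∎))
      where
      open ≈-Reasoning
      reshape : ∀ a → (+ 3 * a) * (+ 3 * a) ≡ + 3 * (1ℤ + + 3 * (a * a)) - + 3
      reshape a = solve (a ∷ [])

    X : ℕ → ℤ
    X m = + 2 * y₀ + + 6 * u₀ * + m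

    T : ℕ → ℤ
    T m = - X m * proj₁ (≉0⇒invertible (D≉0 m))

    TD≈-X : ∀ m → T m * D m ≈ - X m
    TD≈-X m = begin
      - X m * D⁻¹ * D m     ≡⟨ regroup (- X m) D⁻¹ (D m) ⟩
      - X m * (D m * D⁻¹)   ≈⟨ *-cong (≈-refl { - X m}) (proj₂ (≉0⇒invertible (D≉0 m))) ⟩
      - X m * 1ℤ            ≡⟨ ℤ.*-identityʳ (- X m) ⟩
      - X m                 ∎
      where
      open ≈-Reasoning
      D⁻¹ = proj₁ (≉0⇒invertible (D≉0 m))
      regroup : ∀ a b c → a * b * c ≡ a * (c * b)
      regroup a b c = solve (a ∷ b ∷ c ∷ [])

    T≈0⇒X≈0 : ∀ {m} → T m ≈ 0ℤ → X m ≈ 0ℤ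
    T≈0⇒X≈0 {m} T≈0 = -‿injective {X m} {0ℤ}
      (≈-trans (≈-sym (TD≈-X m)) (≈-trans (*-cong T≈0 (≈-refl {D m})) (≈-reflexive (ℤ.*-zeroˡ (D m)))))

    -- The line (y₀ + t, u₀ + m t) meets the conic at t = 0 and at t = T m, and the line
    -- y = y₀ meets it again at the reflection of P₀.
    line-point : ℕ → Point
    line-point m = point (y₀ + T m) (u₀ + + m * T m) (begin
      (y₀ + T m) * (y₀ + T m) + + 3 * ((u₀ + + m * T m) * (u₀ + + m * T m))
        ≡⟨ expand y₀ u₀ (+ m) (T m) ⟩
      (y₀ * y₀ + + 3 * (u₀ * u₀)) + T m * (X m + T m * D m)
        ≈⟨ +-cong (on-conic P₀) (*-cong (≈-refl {T m}) X+TD≈0) ⟩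
      - + 12 + T m * 0ℤ
        ≡⟨ cong (λ z → - + 12 + z) (ℤ.*-zeroʳ (T m)) ⟩
      - + 12 ∎)
      where
      open ≈-Reasoning
      X+TD≈0 : X m + T m * D m ≈ 0ℤ
      X+TD≈0 = ≈-trans (+-cong (≈-refl {X m}) (TD≈-X m)) (≈-reflexive (ℤ.+-inverseʳ (X m)))
      expand : ∀ a b c t → (a + t) * (a + t) + + 3 * ((b + c * t) * (b + c * t))
                         ≡ (a * a + + 3 * (b * b)) + t * ((+ 2 * a + + 6 * b * c) + t * (1ℤ + + 3 * (c * c)))
      expand a b c t = solve (a ∷ b ∷ c ∷ t ∷ [])

    reflection : Point
    reflection = point y₀ (- u₀)
      (≈-trans (≈-reflexive (cong (λ z → y₀ * y₀ + + 3 * z) (neg-square u₀))) (on-conic P₀))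
      where
      neg-square : ∀ a → - a * - a ≡ a * a
      neg-square a = solve (a ∷ [])

    lines-injective : ∀ {m m′} → m < p → m′ < p → line-point m ≅ line-point m′ → m ≡ m′
    lines-injective {m} {m′} m<p m′<p (y≈ , u≈) =
      [ (reduced-≈⇒≡ m<p m′<p ∘ -≈0⇒≈) , T≈0⇒≡ ]′ (x*y≈0⇒x≈0⊎y≈0 {+ m - + m′} (begin
        (+ m - + m′) * T m       ≡⟨ distrib (+ m) (+ m′) (T m) ⟩
        + m * T m - + m′ * T m
          ≈⟨ ≈⇒-≈0 (≈-trans (+-cancelˡ {u₀} u≈) (*-cong (≈-refl {+ m′}) (≈-sym Tm≈Tm′))) ⟩
        0ℤ                       ∎))
      where
      open ≈-Reasoning
      distrib : ∀ a b t → (a - b) * t ≡ a * t - b * t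
      distrib a b t = solve (a ∷ b ∷ t ∷ [])
      Tm≈Tm′ : T m ≈ T m′
      Tm≈Tm′ = +-cancelˡ {y₀} y≈
      T≈0⇒≡ : T m ≈ 0ℤ → m ≡ m′
      T≈0⇒≡ Tm≈0 =
        [ (λ 6u₀≈0 → ⊥-elim (*-≉0 (*-≉0 2≉0 3≉0) u₀≉0 6u₀≈0)) , reduced-≈⇒≡ m<p m′<p ∘ -≈0⇒≈ ]′
        (x*y≈0⇒x≈0⊎y≈0 {+ 6 * u₀} (begin
          + 6 * u₀ * (+ m - + m′)   ≡⟨ difference y₀ u₀ (+ m) (+ m′) ⟩
          X m - X m′
            ≈⟨ +-cong (T≈0⇒X≈0 Tm≈0) (-‿cong (T≈0⇒X≈0 (≈-trans (≈-sym Tm≈Tm′) Tm≈0))) ⟩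
          0ℤ                         ∎))
        where
        difference : ∀ a b c d → + 6 * b * (c - d) ≡ (+ 2 * a + + 6 * b * c) - (+ 2 * a + + 6 * b * d)
        difference a b c d = solve (a ∷ b ∷ c ∷ d ∷ [])

    line≇reflection : ∀ m → ¬ (line-point m ≅ reflection)
    line≇reflection m (y≈ , u≈) = u₀≉0 ([ (λ 2≈0 → ⊥-elim (2≉0 2≈0)) , (λ 2u₀≈0 → 2u₀≈0) ]′
      (x*y≈0⇒x≈0⊎y≈0 {+ 2} (begin
        + 2 * u₀                 ≡⟨ twice u₀ (+ m) ⟩
        (u₀ + + m * 0ℤ) - - u₀
          ≈⟨ +-cong (+-cong (≈-refl {u₀}) (*-cong (≈-refl {+ m}) (≈-sym Tm≈0))) (≈-refl { - - u₀}) ⟩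
        (u₀ + + m * T m) - - u₀  ≈⟨ ≈⇒-≈0 u≈ ⟩
        0ℤ                       ∎)))
      where
      open ≈-Reasoning
      Tm≈0 : T m ≈ 0ℤ
      Tm≈0 = +-cancelˡ {y₀} (≈-trans y≈ (≈-reflexive (sym (ℤ.+-identityʳ y₀))))
      twice : ∀ a c → + 2 * a ≡ (a + c * 0ℤ) - - a
      twice a c = solve (a ∷ c ∷ [])

    family : Fin p ⊎ ⊤ → Point
    family (inj₁ m) = line-point (toℕ m)
    family (inj₂ _) = reflection

    family-injective : ∀ {i j} → family i ≅ family j → i ≡ j
    family-injective {inj₁ m} {inj₁ m′} eq =
      cong inj₁ (Fin.toℕ-injective (lines-injective (Fin.toℕ<n m) (Fin.toℕ<n m′) eq))
    family-injective {inj₁ m} {inj₂ _}  eq = ⊥-elim (line≇reflection (toℕ m) eq)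
    family-injective {inj₂ _} {inj₁ m}  (y≈ , u≈) =
      ⊥-elim (line≇reflection (toℕ m) (≈-sym y≈ , ≈-sym u≈))
    family-injective {inj₂ _} {inj₂ _}  _  = refl

  square≈-3⇒≉0 : ∀ {s} → s * s ≈ - + 3 → s ≉ 0ℤ
  square≈-3⇒≉0 {s} s²≈-3 s≈0 = 3≉0 (-‿injective {+ 3} {0ℤ}
    (≈-trans (≈-sym s²≈-3) (*-cong s≈0 s≈0)))

  module Split {s h t : ℤ} (s²≈-3 : s * s ≈ - + 3) (2h≈1 : + 2 * h ≈ 1ℤ) (st≈1 : s * t ≈ 1ℤ) where

    Y U : ℤ → ℤ → ℤ
    Y a b = h * (a + b)
    U a b = h * t * (b - a)

    Y-sU≈a : ∀ a b → Y a b - s * U a b ≈ a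
    Y-sU≈a a b = begin
      h * (a + b) - s * (h * t * (b - a))        ≡⟨ solve (s ∷ h ∷ t ∷ a ∷ b ∷ []) ⟩
      h * (a + b) - s * t * (h * (b - a))
        ≈⟨ +-cong (≈-refl {h * (a + b)}) (-‿cong (*-cong st≈1 (≈-refl {h * (b - a)}))) ⟩
      h * (a + b) - 1ℤ * (h * (b - a))           ≡⟨ solve (h ∷ a ∷ b ∷ []) ⟩
      + 2 * h * a                                ≈⟨ *-cong 2h≈1 (≈-refl {a}) ⟩
      1ℤ * a                                     ≡⟨ ℤ.*-identityˡ a ⟩
      a                                          ∎
      where open ≈-Reasoning

    Y+sU≈b : ∀ a b → Y a b + s * U a b ≈ b
    Y+sU≈b a b = begin
      h * (a + b) + s * (h * t * (b - a))        ≡⟨ solve (s ∷ h ∷ t ∷ a ∷ b ∷ []) ⟩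
      h * (a + b) + s * t * (h * (b - a))
        ≈⟨ +-cong (≈-refl {h * (a + b)}) (*-cong st≈1 (≈-refl {h * (b - a)})) ⟩
      h * (a + b) + 1ℤ * (h * (b - a))           ≡⟨ solve (h ∷ a ∷ b ∷ []) ⟩
      + 2 * h * b                                ≈⟨ *-cong 2h≈1 (≈-refl {b}) ⟩
      1ℤ * b                                     ≡⟨ ℤ.*-identityˡ b ⟩
      b                                          ∎
      where open ≈-Reasoning

    split-point : ∀ a b → a * b ≈ - + 12 → Point
    split-point a b ab≈-12 = point (Y a b) (U a b) (begin
      Y a b * Y a b + + 3 * (U a b * U a b)
        ≈⟨ +-cong (≈-refl {Y a b * Y a b}) (*-cong (-‿cong (≈-sym s²≈-3)) (≈-refl {U a b * U a b})) ⟩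
      Y a b * Y a b + - (s * s) * (U a b * U a b)          ≡⟨ factor (Y a b) (U a b) ⟩
      (Y a b - s * U a b) * (Y a b + s * U a b)            ≈⟨ *-cong (Y-sU≈a a b) (Y+sU≈b a b) ⟩
      a * b                                                ≈⟨ ab≈-12 ⟩
      - + 12                                               ∎)
      where
      open ≈-Reasoning
      factor : ∀ y u → y * y + - (s * s) * (u * u) ≡ (y - s * u) * (y + s * u)
      factor y u = solve (y ∷ u ∷ s ∷ [])

    factor-point : ∀ a → a ≉ 0ℤ → Point
    factor-point a a≉0 with a⁻¹ , aa⁻¹≈1 ← ≉0⇒invertible a≉0 = split-point a (- + 12 * a⁻¹) (begin
      a * (- + 12 * a⁻¹)   ≡⟨ solve (a ∷ a⁻¹ ∷ []) ⟩
      - + 12 * (a * a⁻¹)   ≈⟨ *-cong (≈-refl { - + 12}) aa⁻¹≈1 ⟩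
      - + 12 * 1ℤ          ∎)
      where open ≈-Reasoning

    factor-point-y-su : ∀ a (a≉0 : a ≉ 0ℤ) → y (factor-point a a≉0) - s * u (factor-point a a≉0) ≈ a
    factor-point-y-su a a≉0 = Y-sU≈a a _

    1+i<p : ∀ (i : Fin (q ℕ.+ q)) → suc (toℕ i) < p
    1+i<p i = subst (suc (toℕ i) <_) (sym p≡2q+1) (s≤s (Fin.toℕ<n i))

    family : Fin (q ℕ.+ q) → Point
    family i = factor-point (+ suc (toℕ i)) (<p⇒≉0 (s≤s z≤n) (1+i<p i))

    family-injective : ∀ {i j} → family i ≅ family j → i ≡ j
    family-injective {i} {j} (y≈ , u≈) =
      Fin.toℕ-injective (ℕ.suc-injective (reduced-≈⇒≡ (1+i<p i) (1+i<p j) (begin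
      + suc (toℕ i)                            ≈⟨ factor-point-y-su _ _ ⟨
      y (family i) - s * u (family i)          ≈⟨ +-cong y≈ (-‿cong (*-cong (≈-refl {s}) u≈)) ⟩
      y (family j) - s * u (family j)          ≈⟨ factor-point-y-su _ _ ⟩
      + suc (toℕ j)                            ∎)))
      where open ≈-Reasoning

  module Encoding (δ : ℕ) (δ≉0 : + δ ≉ 0ℤ) (L : ℕ)
                  (no-small : ∀ x → 1 ≤ x → x ≤ L → ¬ Cond p δ x) where

    δ⁻¹ : ℤ
    δ⁻¹ = proj₁ (≉0⇒invertible δ≉0)

    v : Point → ℕ
    v P = (u P * δ⁻¹) %ℕ p

    x : Point → ℕ
    x P = fold (v P)

    v<p : ∀ P → v P < p
    v<p P = n%ℕd<d (u P * δ⁻¹) p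

    δv≈u : ∀ P → + δ * + v P ≈ u P
    δv≈u P = begin
      + δ * + v P              ≈⟨ *-cong (≈-refl {+ δ}) (≈-sym (≈-%ℕ (u P * δ⁻¹))) ⟩
      + δ * (u P * δ⁻¹)        ≡⟨ regroup (+ δ) (u P) δ⁻¹ ⟩
      (+ δ * δ⁻¹) * u P        ≈⟨ *-cong (proj₂ (≉0⇒invertible δ≉0)) ≈-refl ⟩
      1ℤ * u P                 ≡⟨ ℤ.*-identityˡ (u P) ⟩
      u P                      ∎
      where
      open ≈-Reasoning
      regroup : ∀ d a e → d * (a * e) ≡ (d * e) * a
      regroup d a e = solve (d ∷ a ∷ e ∷ [])

    δx-square : ∀ P → (+ δ * + x P) * (+ δ * + x P) ≈ u P * u P
    δx-square P = begin
      (+ δ * + x P) * (+ δ * + x P)    ≡⟨ square-* (+ δ) (+ x P) ⟩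
      + δ * + δ * (+ x P * + x P)      ≈⟨ *-cong (≈-refl {+ δ * + δ}) (fold-square (v<p P)) ⟩
      + δ * + δ * (+ v P * + v P)      ≡⟨ square-* (+ δ) (+ v P) ⟨
      (+ δ * + v P) * (+ δ * + v P)    ≈⟨ *-cong (δv≈u P) (δv≈u P) ⟩
      u P * u P                        ∎
      where
      open ≈-Reasoning
      square-* : ∀ a b → (a * b) * (a * b) ≡ a * a * (b * b)
      square-* a b = solve (a ∷ b ∷ [])

    cond : ∀ P → Cond p δ (x P)
    cond P = Equivalence.from (legendre⇔square _) (y P , (begin
      y P * y P                                         ≈⟨ y²≈-12-3u² P ⟩
      - + 12 - + 3 * (u P * u P)                        ≈⟨ -12-3*-cong (≈-sym (δx-square P)) ⟩
      - + 12 - + 3 * ((+ δ * + x P) * (+ δ * + x P))    ≡⟨ reshape (+ δ) (+ x P) ⟩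
      - + 3 * + δ * + δ * + x P * + x P - + 12          ∎))
      where
      open ≈-Reasoning
      reshape : ∀ d a → - + 12 - + 3 * ((d * a) * (d * a)) ≡ - + 3 * d * d * a * a - + 12
      reshape d a = solve (d ∷ a ∷ [])

    v-positive : ∀ P → u P ≉ 0ℤ → 0 < v P
    v-positive P u≉0 with v P in vP≡0
    ... | zero  = ⊥-elim (u≉0 (begin
      u P           ≈⟨ δv≈u P ⟨
      + δ * + v P   ≡⟨ cong (λ r → + δ * + r) vP≡0 ⟩
      + δ * 0ℤ      ≡⟨ ℤ.*-zeroʳ (+ δ) ⟩
      0ℤ            ∎))
      where open ≈-Reasoning
    ... | suc _ = s≤s z≤n

    L<x : ∀ P → u P ≉ 0ℤ → L < x P
    L<x P u≉0 = ℕ.≰⇒> λ x≤L → no-small (x P) (fold-positive (v-positive P u≉0) (v<p P)) x≤L (cond P)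

    slot<q∸L : ∀ P → u P ≉ 0ℤ → x P ∸ suc L < q ∸ L
    slot<q∸L P u≉0 =
      ℕ.<-≤-trans (ℕ.∸-monoʳ-< (ℕ.n<1+n L) (L<x P u≉0)) (ℕ.∸-monoˡ-≤ L (fold≤q (v<p P)))

    code≉0 : ∀ P → u P ≉ 0ℤ → Fin (q ∸ L) × Bool × Bool
    code≉0 P u≉0 = fromℕ< (slot<q∸L P u≉0) , upper (v P) , upper (y P %ℕ p)

    code≉0-injective : ∀ {P Q} (uP≉0 : u P ≉ 0ℤ) (uQ≉0 : u Q ≉ 0ℤ) →
                       code≉0 P uP≉0 ≡ code≉0 Q uQ≉0 → P ≅ Q
    code≉0-injective {P} {Q} uP≉0 uQ≉0 eq = y-determined {P} {Q} uP≈uQ same-y-half , uP≈uQ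
      where
      same-slot = proj₁ (,-injective eq)
      same-v-half = proj₁ (,-injective (proj₂ (,-injective eq)))
      same-y-half = proj₂ (,-injective (proj₂ (,-injective eq)))
      xP≡xQ : x P ≡ x Q
      xP≡xQ = ℕ.∸-cancelʳ-≡ (L<x P uP≉0) (L<x Q uQ≉0) (Fin.fromℕ<-injective _ _ _ _ same-slot)
      vP≡vQ : v P ≡ v Q
      vP≡vQ = ≡-from-square-and-half (v<p P) (v<p Q) (begin
        + v P * + v P     ≈⟨ fold-square (v<p P) ⟨
        + x P * + x P     ≡⟨ cong (λ r → + r * + r) xP≡xQ ⟩
        + x Q * + x Q     ≈⟨ fold-square (v<p Q) ⟩
        + v Q * + v Q     ∎) same-v-half
        where open ≈-Reasoning
      uP≈uQ : u P ≈ u Q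
      uP≈uQ = begin
        u P           ≈⟨ δv≈u P ⟨
        + δ * + v P   ≡⟨ cong (λ r → + δ * + r) vP≡vQ ⟩
        + δ * + v Q   ≈⟨ δv≈u Q ⟩
        u Q           ∎
        where open ≈-Reasoning

    code : Point → (Fin (q ∸ L) × Bool × Bool) ⊎ Bool
    code P with u P ≈? 0ℤ
    ... | yes _   = inj₂ (upper (y P %ℕ p))
    ... | no u≉0 = inj₁ (code≉0 P u≉0)

    code-injective : ∀ {P Q} → code P ≡ code Q → P ≅ Q
    code-injective {P} {Q} with u P ≈? 0ℤ | u Q ≈? 0ℤ
    ... | yes uP≈0 | yes uQ≈0 = λ eq →
      y-determined {P} {Q} (≈-trans uP≈0 (≈-sym uQ≈0)) (inj₂-injective eq) , ≈-trans uP≈0 (≈-sym uQ≈0)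
    ... | no uP≉0  | no uQ≉0  = λ eq → code≉0-injective {P} {Q} uP≉0 uQ≉0 (inj₁-injective eq)
    ... | yes _    | no _     = λ ()
    ... | no _     | yes _    = λ ()

    points-bound : ∀ {I : Set} {N} → I ↔ Fin N → (P : I → Point) → (∀ {i j} → P i ≅ P j → i ≡ j) →
                   N ≤ (q ∸ L) ℕ.* 4 ℕ.+ 2
    points-bound I↔Fin P P-injective =
      injective⇒card≤ I↔Fin (Fin×Bool×Bool⊎Bool↔ (q ∸ L)) (code ∘ P)
        (λ {i} {j} eq → P-injective (code-injective {P i} {P j} eq))

    points≉0-bound : ∀ {I : Set} {N} → I ↔ Fin N → (P : I → Point) → (∀ i → u (P i) ≉ 0ℤ) →
                     (∀ {i j} → P i ≅ P j → i ≡ j) → N ≤ (q ∸ L) ℕ.* 4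
    points≉0-bound I↔Fin P u≉0 P-injective =
      injective⇒card≤ I↔Fin (Fin×Bool×Bool↔ (q ∸ L)) (λ i → code≉0 (P i) (u≉0 i))
        (λ {i} {j} eq → P-injective (code≉0-injective {P i} {P j} (u≉0 i) (u≉0 j) eq))

    nonsquare-bound : ¬ IsSquare (- + 3) → p ℕ.+ 1 ≤ (q ∸ L) ℕ.* 4
    nonsquare-bound ¬□ = points≉0-bound (↔-sym (↔-trans Fin.+↔⊎ (↔-refl ⊎-↔ Fin.1↔⊤)))
      family (λ i → nonsquare⇒u≉0 ¬□ (family i)) family-injective
      where open Lines ¬□ some-point

    square-bound : IsSquare (- + 3) → q ℕ.+ q ≤ (q ∸ L) ℕ.* 4 ℕ.+ 2
    square-bound (s , s²≈-3)
      with h , 2h≈1 ← ≉0⇒invertible 2≉0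
      with t , st≈1 ← ≉0⇒invertible {s} (square≈-3⇒≉0 {s} s²≈-3) =
      points-bound ↔-refl family family-injective
      where open Split {s} {h} {t} s²≈-3 2h≈1 st≈1

module Main (p : ℕ) (p-prime : Prime p) (5≤p : 5 ≤ p) (δ : ℕ) (p∤δ : ¬ p ∣ δ) where

  open LpBounds
  open LargePrime p p-prime 5≤p
  open CubeRoots p p-prime 5≤p

  2∤p : ¬ 2 ∣ p
  2∤p = prime⇒∤ p-prime (ℕ.≤-trans (ℕ.m≤n+m 3 2) 5≤p)

  3∤p : ¬ 3 ∣ p
  3∤p = prime⇒∤ p-prime (ℕ.≤-trans (ℕ.m≤n+m 4 1) 5≤p)

  open Conic p p-prime 5≤p (p / 2) (odd⇒≡1+2q 2∤p)
  module E = Encoding δ (p∤δ ∘ ≈0⇒ℕ∣) (Lp p)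

  small-solution : ¬ (∀ x → 1 ≤ x → x ≤ Lp p → ¬ Cond p δ x)
  small-solution no-small with square? (- + 3)
  ... | yes □ = conic-bound-contradiction-1mod3 {p} {p / 2} {Lp p} (odd⇒≡1+2q 2∤p) 5≤p
                  (Lp-lower-bound-1mod3 2∤p 3∤p (-3-square⇒3∣p-1 □)) (E.square-bound no-small □)
  ... | no ¬□ = conic-bound-contradiction {p} {p / 2} {Lp p} (odd⇒≡1+2q 2∤p)
                  (Lp-lower-bound 2∤p 3∤p) (E.nonsquare-bound no-small ¬□)

lemma3p2 : (p δ : ℕ) → Prime p → 5 ≤ p → 1 ≤ δ → ¬ (p ∣ δ) →
    ∃ λ x → IsEllp p δ x × x ≤ Lp p
lemma3p2 p δ p-prime 5≤p _ p∤δ with least-upTo? (λ x → PrimeField.legendre? p p-prime _) (Lp p)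
... | inj₁ solution = solution
... | inj₂ no-small = ⊥-elim (Main.small-solution p p-prime 5≤p δ p∤δ no-small)
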